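{- Let $G_1=K_1$ and let $G_2$ be any connected graph with $|V(G_2)|\geq 2$, and let $G=G_1+G_2$ be their join. Then $F_{xt}(G)\leq F_{xt}(G_2)$. This bound is sharp.
   Context: All graphs are finite, simple; throughout the paper graphs are assumed connected and symmetric (nontrivial automorphism group). A fixing set of $G$ is a set $F\subseteq V(G)$ such that the only automorphism fixing every vertex of $F$ is the identity. A fixatic partition of $G$ is a partition of $V(G)$ into classes each of which is a fixing set; $F_{xt}(G)$ is the maximum number of classes in a fixatic partition. The join $G_1+G_2$ is $G_1\cup G_2$ together with all edges between $V(G_1)$ and $V(G_2)$. -}

module Defs where

open import Data.Nat using (ℕ; zero; suc; _≤_; _≥_)
open import Data.Fin using (Fin; zero; suc)
open import Data.Fin.Permutation using (Permutation′; _⟨$⟩ʳ_)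
open import Data.Bool using (Bool; true; false)
open import Data.Product using (Σ; ∃; ∃-syntax; _×_; _,_)
open import Relation.Binary.PropositionalEquality using (_≡_; refl)
open import Relation.Nullary using (¬_)

record Graph : Set where
  field
    n     : ℕ
    adj   : Fin n → Fin n → Bool
    sym   : ∀ i j → adj i j ≡ adj j i
    loopless : ∀ i → adj i i ≡ false
open Graph public

data Reach (G : Graph) : Fin (n G) → Fin (n G) → Set where
  here : ∀ {u} → Reach G u u
  step : ∀ {u w v} → adj G u w ≡ true → Reach G w v → Reach G u v

Connected : Graph → Set
Connected G = ∀ u v → Reach G u v

IsAutomorphism : (G : Graph) → Permutation′ (n G) → Set
IsAutomorphism G σ = ∀ i j → adj G (σ ⟨$⟩ʳ i) (σ ⟨$⟩ʳ j) ≡ adj G i j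

IsIdentity : (G : Graph) → Permutation′ (n G) → Set
IsIdentity G σ = ∀ v → σ ⟨$⟩ʳ v ≡ v

Symmetric : Graph → Set
Symmetric G = ∃[ σ ] (IsAutomorphism G σ × ¬ IsIdentity G σ)

IsFixingSet : (G : Graph) → (Fin (n G) → Set) → Set
IsFixingSet G F = ∀ σ → IsAutomorphism G σ → (∀ v → F v → σ ⟨$⟩ʳ v ≡ v) → IsIdentity G σ

-- A partition of V(G) into k (nonempty) classes, given by the class map
-- c : V → Fin k, surjective; class i is { v | c v ≡ i }.
-- It is fixatic if every class is a fixing set.
IsFixaticPartition : (G : Graph) (k : ℕ) → (Fin (n G) → Fin k) → Set
IsFixaticPartition G k c =
  (∀ i → ∃[ v ] c v ≡ i) × (∀ i → IsFixingSet G (λ v → c v ≡ i))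

HasFixaticPartition : Graph → ℕ → Set
HasFixaticPartition G k = ∃[ c ] IsFixaticPartition G k c

IsFxt : Graph → ℕ → Set
IsFxt G k = HasFixaticPartition G k × (∀ m → HasFixaticPartition G m → m ≤ k)

-- Join K₁ + G : new apex vertex zero adjacent to every vertex suc i of G.
joinAdj : (G : Graph) → Fin (suc (n G)) → Fin (suc (n G)) → Bool
joinAdj G zero zero = false
joinAdj G zero (suc j) = true
joinAdj G (suc i) zero = true
joinAdj G (suc i) (suc j) = adj G i j

joinSym : (G : Graph) → ∀ i j → joinAdj G i j ≡ joinAdj G j i
joinSym G zero zero = refl
joinSym G zero (suc j) = refl
joinSym G (suc i) zero = refl
joinSym G (suc i) (suc j) = sym G i j

joinLoopless : (G : Graph) → ∀ i → joinAdj G i i ≡ false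
joinLoopless G zero = refl
joinLoopless G (suc i) = loopless G i

K1+_ : Graph → Graph
K1+ G = record { n = suc (n G) ; adj = joinAdj G ; sym = joinSym G ; loopless = joinLoopless G }

module Submission where

-- Every automorphism σ of G₂ extends to the automorphism
-- lift₀ σ of K₁ + G₂ that fixes the apex.  Hence the trace on V(G₂) of a
-- fixing set of K₁ + G₂ is a fixing set of G₂.  If G₂ is symmetric, such a
-- trace is moreover nonempty: a fixing set must contain a vertex moved by
-- any nontrivial automorphism, and the lift of a nontrivial automorphism
-- of G₂ moves only vertices of G₂.  So deleting the apex turns a fixatic
-- partition of K₁ + G₂ into k classes into one of G₂ into k classes, and
-- F_xt(K₁ + G₂) ≤ F_xt(G₂).
--
-- For the path P₃ = 0 - 1 - 2, the reflection 0 ↔ 2 moves only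
-- the two end vertices, so every fixing set contains an end vertex and
-- F_xt(P₃) ≤ 2.  K₁ + P₃ (the complete graph K₄ minus an edge) has the
-- fixatic partition {apex, 1}, {2, 3}; deleting the apex gives a fixatic
-- partition of P₃ into two classes, so F_xt(K₁ + P₃) = F_xt(P₃) = 2.

open import Defs
open import Data.Nat using (ℕ; _≤_; _≥_; z≤n; s≤s)
open import Data.Product using (∃; ∃-syntax; _×_; _,_; proj₁; proj₂)
open import Data.Sum using (_⊎_; inj₁; inj₂)
open import Data.Fin using (Fin; zero; suc)
open import Data.Fin.Properties using (any?; suc-injective; _≟_; injective⇒≤)
open import Data.Fin.Permutation using (Permutation′; _⟨$⟩ʳ_; lift₀; permutation)
open import Data.Bool using (Bool; true; false)
open import Data.Empty using (⊥-elim)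
open import Function.Base using (_∘_)
open import Function.Bundles using (Injection)
open import Function.Properties.Inverse using (↔⇒↣)
open import Relation.Unary using (Decidable)
open import Relation.Nullary using (¬_; yes; no)
open import Relation.Binary.PropositionalEquality
  using (_≡_; _≢_; refl; trans; cong) renaming (sym to ≡-sym)

permutation-injective : ∀ {k} (σ : Permutation′ k) {x y} → σ ⟨$⟩ʳ x ≡ σ ⟨$⟩ʳ y → x ≡ y
permutation-injective σ = Injection.injective (↔⇒↣ σ)

fixedByElimination : ∀ {k} (σ : Permutation′ k) (v : Fin k) →
                     (∀ x → x ≢ v → σ ⟨$⟩ʳ x ≡ x) → ∀ x → σ ⟨$⟩ʳ x ≡ x
fixedByElimination σ v others x with x ≟ v
... | no x≢v = others x x≢v
... | yes refl with σ ⟨$⟩ʳ v ≟ v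
...   | yes σv≡v = σv≡v
...   | no σv≢v = ⊥-elim (σv≢v (permutation-injective σ (others (σ ⟨$⟩ʳ v) σv≢v)))

fixesUniqueNonNeighbour : (G : Graph) (σ : Permutation′ (n G)) → IsAutomorphism G σ →
                          ∀ {u w} → σ ⟨$⟩ʳ u ≡ u → w ≢ u → adj G u w ≡ false →
                          (∀ x → adj G u x ≡ false → x ≡ u ⊎ x ≡ w) → σ ⟨$⟩ʳ w ≡ w
fixesUniqueNonNeighbour G σ aut {u} {w} σu≡u w≢u uw nonNeighbours
  with nonNeighbours (σ ⟨$⟩ʳ w) σu-σw
  where
  -- σ preserves the non-adjacency of u and w, and σ u = u.
  σu-σw : adj G u (σ ⟨$⟩ʳ w) ≡ false
  σu-σw = trans (cong (λ x → adj G x (σ ⟨$⟩ʳ w)) (≡-sym σu≡u)) (trans (aut u w) uw)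
... | inj₁ σw≡u = ⊥-elim (w≢u (permutation-injective σ (trans σw≡u (≡-sym σu≡u))))
... | inj₂ σw≡w = σw≡w

SupportedOn : ∀ {k s} → Permutation′ k → (Fin s → Fin k) → Set
SupportedOn σ e = ∀ v → σ ⟨$⟩ʳ v ≡ v ⊎ ∃[ j ] e j ≡ v

fixingSetMeetsSupport : (G : Graph) {s : ℕ} (e : Fin s → Fin (n G)) (σ : Permutation′ (n G)) →
                        IsAutomorphism G σ → ¬ IsIdentity G σ → SupportedOn σ e →
                        (F : Fin (n G) → Set) → Decidable F → IsFixingSet G F → ∃[ j ] F (e j)
fixingSetMeetsSupport G e σ aut nontrivial support F F? fixing with any? (F? ∘ e)
... | yes meets = meets
... | no misses = ⊥-elim (nontrivial (fixing σ aut fixesF))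
  where
  fixesF : ∀ v → F v → σ ⟨$⟩ʳ v ≡ v
  fixesF v Fv with support v
  ... | inj₁ fixed = fixed
  ... | inj₂ (j , refl) = ⊥-elim (misses (j , Fv))

-- Consequently a fixatic partition has at most as many classes as the
-- support of any nontrivial automorphism has vertices: each class picks a
-- support vertex of its own.
fixaticClassesBoundedBySupport : (G : Graph) {s : ℕ} (e : Fin s → Fin (n G)) (σ : Permutation′ (n G)) →
                                 IsAutomorphism G σ → ¬ IsIdentity G σ → SupportedOn σ e →
                                 ∀ m → HasFixaticPartition G m → m ≤ s
fixaticClassesBoundedBySupport G {s} e σ aut nontrivial support m (c , _ , fixing) =
  injective⇒≤ pick-injective
  where
  meets : ∀ i → ∃[ j ] c (e j) ≡ i
  meets i = fixingSetMeetsSupport G e σ aut nontrivial support _ (λ v → c v ≟ i) (fixing i)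
  pick : Fin m → Fin s
  pick i = proj₁ (meets i)
  pick-injective : ∀ {i i′} → pick i ≡ pick i′ → i ≡ i′
  pick-injective {i} {i′} same =
    trans (≡-sym (proj₂ (meets i))) (trans (cong (c ∘ e) same) (proj₂ (meets i′)))

liftAutomorphism : (G : Graph) (σ : Permutation′ (n G)) → IsAutomorphism G σ →
                   IsAutomorphism (K1+ G) (lift₀ σ)
liftAutomorphism G σ aut zero zero = refl
liftAutomorphism G σ aut zero (suc j) = refl
liftAutomorphism G σ aut (suc i) zero = refl
liftAutomorphism G σ aut (suc i) (suc j) = aut i j

liftSupportedOnG : ∀ {k} (σ : Permutation′ k) → SupportedOn (lift₀ σ) suc
liftSupportedOnG σ zero = inj₁ refl
liftSupportedOnG σ (suc v) = inj₂ (v , refl)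

restrictFixingSet : (G : Graph) (F : Fin (n (K1+ G)) → Set) →
                    IsFixingSet (K1+ G) F → IsFixingSet G (F ∘ suc)
restrictFixingSet G F fixing σ aut fixesF v =
  suc-injective (fixing (lift₀ σ) (liftAutomorphism G σ aut) fixesLiftF (suc v))
  where
  fixesLiftF : ∀ v → F v → lift₀ σ ⟨$⟩ʳ v ≡ v
  fixesLiftF zero _ = refl
  fixesLiftF (suc w) Fw = cong suc (fixesF w Fw)

-- Deleting the apex of K₁ + G turns a fixatic partition into one of G with
-- the same number of classes, provided G is symmetric (so that no class
-- consists of the apex alone).
restrictPartition : (G : Graph) → Symmetric G → ∀ m →
                    HasFixaticPartition (K1+ G) m → HasFixaticPartition G m
restrictPartition G (σ , aut , nontrivial) m (c , _ , fixing) =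
  c ∘ suc , nonempty , (λ i → restrictFixingSet G _ (fixing i))
  where
  liftNontrivial : ¬ IsIdentity (K1+ G) (lift₀ σ)
  liftNontrivial isId = nontrivial (λ v → suc-injective (isId (suc v)))
  nonempty : ∀ i → ∃[ v ] c (suc v) ≡ i
  nonempty i = fixingSetMeetsSupport (K1+ G) suc (lift₀ σ) (liftAutomorphism G σ aut)
                 liftNontrivial (liftSupportedOnG σ) _ (λ v → c v ≟ i) (fixing i)

fxtJoinBound : (G : Graph) → Symmetric G → ∀ a b → IsFxt (K1+ G) a → IsFxt G b → a ≤ b
fxtJoinBound G symmetric a b (partition , _) (_ , maximal) =
  maximal a (restrictPartition G symmetric a partition)

pattern v0 = zero
pattern v1 = suc zero
pattern v2 = suc (suc zero)
pattern v3 = suc (suc (suc zero))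

adjP3 : Fin 3 → Fin 3 → Bool
adjP3 v0 v1 = true
adjP3 v1 v0 = true
adjP3 v1 v2 = true
adjP3 v2 v1 = true
adjP3 _ _ = false

adjP3-sym : ∀ i j → adjP3 i j ≡ adjP3 j i
adjP3-sym v0 v0 = refl
adjP3-sym v0 v1 = refl
adjP3-sym v0 v2 = refl
adjP3-sym v1 v0 = refl
adjP3-sym v1 v1 = refl
adjP3-sym v1 v2 = refl
adjP3-sym v2 v0 = refl
adjP3-sym v2 v1 = refl
adjP3-sym v2 v2 = refl

adjP3-loopless : ∀ i → adjP3 i i ≡ false
adjP3-loopless v0 = refl
adjP3-loopless v1 = refl
adjP3-loopless v2 = refl

P3 : Graph
P3 = record { n = 3 ; adj = adjP3 ; sym = adjP3-sym ; loopless = adjP3-loopless }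

P3-connected : Connected P3
P3-connected v0 v0 = here
P3-connected v0 v1 = step refl here
P3-connected v0 v2 = step {w = v1} refl (step refl here)
P3-connected v1 v0 = step refl here
P3-connected v1 v1 = here
P3-connected v1 v2 = step refl here
P3-connected v2 v0 = step {w = v1} refl (step refl here)
P3-connected v2 v1 = step refl here
P3-connected v2 v2 = here

reflect : Fin 3 → Fin 3
reflect v0 = v2
reflect v1 = v1
reflect v2 = v0

reflect-involutive : ∀ i → reflect (reflect i) ≡ i
reflect-involutive v0 = refl
reflect-involutive v1 = refl
reflect-involutive v2 = refl

reflection : Permutation′ 3
reflection = permutation reflect reflect reflect-involutive reflect-involutive

reflection-automorphism : IsAutomorphism P3 reflection
reflection-automorphism v0 v0 = refl
reflection-automorphism v0 v1 = refl
reflection-automorphism v0 v2 = refl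
reflection-automorphism v1 v0 = refl
reflection-automorphism v1 v1 = refl
reflection-automorphism v1 v2 = refl
reflection-automorphism v2 v0 = refl
reflection-automorphism v2 v1 = refl
reflection-automorphism v2 v2 = refl

reflection-nontrivial : ¬ IsIdentity P3 reflection
reflection-nontrivial isId with isId v0
... | ()

P3-symmetric : Symmetric P3
P3-symmetric = reflection , reflection-automorphism , reflection-nontrivial

endVertex : Fin 2 → Fin 3
endVertex zero = v0
endVertex (suc zero) = v2

reflection-supportedOnEnds : SupportedOn reflection endVertex
reflection-supportedOnEnds v0 = inj₂ (zero , refl)
reflection-supportedOnEnds v1 = inj₁ refl
reflection-supportedOnEnds v2 = inj₂ (suc zero , refl)

P3-fxt≤2 : ∀ m → HasFixaticPartition P3 m → m ≤ 2
P3-fxt≤2 = fixaticClassesBoundedBySupport P3 endVertex reflection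
             reflection-automorphism reflection-nontrivial reflection-supportedOnEnds

-- The fixatic partition {apex, 1}, {2, 3} of K₁ + P₃.  In K₁ + P₃ the
-- vertices 1 and 3 are each other's unique non-neighbour.

class : Fin 4 → Fin 2
class v0 = zero
class v1 = zero
class v2 = suc zero
class v3 = suc zero

nonNeighbours-1 : ∀ x → adj (K1+ P3) v1 x ≡ false → x ≡ v1 ⊎ x ≡ v3
nonNeighbours-1 v1 _ = inj₁ refl
nonNeighbours-1 v3 _ = inj₂ refl

nonNeighbours-3 : ∀ x → adj (K1+ P3) v3 x ≡ false → x ≡ v3 ⊎ x ≡ v1
nonNeighbours-3 v1 _ = inj₂ refl
nonNeighbours-3 v3 _ = inj₁ refl

-- Fixing {apex, 1}: vertex 3 is fixed as the non-neighbour of 1, and then 2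
-- by elimination.
fixes-apex-1 : ∀ σ → IsAutomorphism (K1+ P3) σ → σ ⟨$⟩ʳ v0 ≡ v0 → σ ⟨$⟩ʳ v1 ≡ v1 →
               IsIdentity (K1+ P3) σ
fixes-apex-1 σ aut fix0 fix1 = fixedByElimination σ v2 others
  where
  fix3 : σ ⟨$⟩ʳ v3 ≡ v3
  fix3 = fixesUniqueNonNeighbour (K1+ P3) σ aut fix1 (λ ()) refl nonNeighbours-1
  others : ∀ x → x ≢ v2 → σ ⟨$⟩ʳ x ≡ x
  others v0 _ = fix0
  others v1 _ = fix1
  others v2 x≢2 = ⊥-elim (x≢2 refl)
  others v3 _ = fix3

-- Fixing {2, 3}: vertex 1 is fixed as the non-neighbour of 3, and then the
-- apex by elimination.
fixes-2-3 : ∀ σ → IsAutomorphism (K1+ P3) σ → σ ⟨$⟩ʳ v2 ≡ v2 → σ ⟨$⟩ʳ v3 ≡ v3 →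
            IsIdentity (K1+ P3) σ
fixes-2-3 σ aut fix2 fix3 = fixedByElimination σ v0 others
  where
  fix1 : σ ⟨$⟩ʳ v1 ≡ v1
  fix1 = fixesUniqueNonNeighbour (K1+ P3) σ aut fix3 (λ ()) refl nonNeighbours-3
  others : ∀ x → x ≢ v0 → σ ⟨$⟩ʳ x ≡ x
  others v0 x≢0 = ⊥-elim (x≢0 refl)
  others v1 _ = fix1
  others v2 _ = fix2
  others v3 _ = fix3

K1+P3-partition : HasFixaticPartition (K1+ P3) 2
K1+P3-partition = class , nonempty , fixing
  where
  nonempty : ∀ i → ∃[ v ] class v ≡ i
  nonempty zero = v0 , refl
  nonempty (suc zero) = v2 , refl
  fixing : ∀ i → IsFixingSet (K1+ P3) (λ v → class v ≡ i)
  fixing zero σ aut fixes = fixes-apex-1 σ aut (fixes v0 refl) (fixes v1 refl)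
  fixing (suc zero) σ aut fixes = fixes-2-3 σ aut (fixes v2 refl) (fixes v3 refl)

P3-fxt : IsFxt P3 2
P3-fxt = restrictPartition P3 P3-symmetric 2 K1+P3-partition , P3-fxt≤2

K1+P3-fxt : IsFxt (K1+ P3) 2
K1+P3-fxt = K1+P3-partition , λ m → P3-fxt≤2 m ∘ restrictPartition P3 P3-symmetric m

mainTheorem10 : (∀ (G₂ : Graph) → Connected G₂ → n G₂ ≥ 2 → Symmetric G₂ →
                   ∀ a b → IsFxt (K1+ G₂) a → IsFxt G₂ b → a ≤ b)
                × (∃[ G₂ ] (Connected G₂ × n G₂ ≥ 2 × Symmetric G₂ ×
                   (∃[ k ] (IsFxt (K1+ G₂) k × IsFxt G₂ k))))
mainTheorem10 =
  (λ G₂ _ _ symmetric → fxtJoinBound G₂ symmetric) ,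
  (P3 , P3-connected , s≤s (s≤s z≤n) , P3-symmetric , (2 , K1+P3-fxt , P3-fxt))
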